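{- Let $G$ be a finite, simple, connected graph and $k\geq1$. If $G$ is circularly $k$-partite, then $G$ is circularly $\ell$-partite for every positive integer $\ell$ dividing $k$.
   Context: All graphs are finite, simple (undirected, no loops, no multi-edges) and connected. An oriented edge $[v,w]$ is an edge $\{v,w\}$ with input $v$ and output $w$; $\mathcal{O}=\{[v,w],[w,v]: v\sim w\}$. For $k\geq 1$, $G$ is circularly $k$-partite if $\mathcal{O}$ can be partitioned as $\mathcal{O}=\mathcal{O}_1\sqcup\cdots\sqcup\mathcal{O}_k$ with all $\mathcal{O}_j$ non-empty and such that $[v,w]\in\mathcal{O}_j$ implies $[w,z]\in\mathcal{O}_{j+1}$ for every $z\sim w$ with $z\neq v$, indices modulo $k$. -}

module Defs where

open import Data.Nat using (ℕ; zero; suc; NonZero; _%_)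
open import Data.Nat.DivMod using (m%n<n)
open import Data.Fin using (Fin; toℕ; fromℕ<)
open import Data.Bool using (Bool; T)
open import Data.Product using (Σ; ∃; _×_; _,_)
open import Relation.Binary.PropositionalEquality using (_≡_)
open import Relation.Binary.Construct.Closure.ReflexiveTransitive using (Star)
open import Relation.Nullary using (¬_)

record Graph (n : ℕ) : Set where
  field
    adj   : Fin n → Fin n → Bool
    sym   : ∀ v w → T (adj v w) → T (adj w v)
    irrefl : ∀ v → ¬ T (adj v v)

module _ {n : ℕ} (G : Graph n) where
  open Graph G

  Adj : Fin n → Fin n → Set
  Adj v w = T (adj v w)

  Connected : Set
  Connected = ∀ v w → Star Adj v w

next : {k : ℕ} .{{_ : NonZero k}} → Fin k → Fin k
next {k} i = fromℕ< (m%n<n (suc (toℕ i)) k)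

-- G is circularly k-partite: the oriented edges [v,w] (v ∼ w) are partitioned
-- into k non-empty classes O_0,…,O_{k-1} (given by the class map c), such that
-- [v,w] ∈ O_j implies [w,z] ∈ O_{j+1 mod k} for every z ∼ w with z ≠ v.
CircularlyPartite : {n : ℕ} → Graph n → (k : ℕ) → .{{_ : NonZero k}} → Set
CircularlyPartite {n} G k =
  Σ ((v w : Fin n) → Adj G v w → Fin k) λ c →
    (∀ (j : Fin k) → ∃ λ v → ∃ λ w → Σ (Adj G v w) λ e → c v w e ≡ j)
    × (∀ v w z (e : Adj G v w) (f : Adj G w z) → ¬ (z ≡ v) → c w z f ≡ next (c v w e))

{-# OPTIONS --safe #-}
module Submission where

-- Reducing class indices modulo ℓ is a surjection Fin k → Fin ℓ that commutes with the
-- cyclic successor whenever ℓ ∣ k; composing a circular k-partition with it gives a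
-- circular ℓ-partition.

open import Defs
open import Data.Nat using (ℕ; NonZero; suc; _+_; _%_)
open import Data.Nat.Divisibility using (_∣_; ∣⇒≤)
open import Data.Nat.DivMod using (m%n<n; m%n%n≡m%n; %-distribˡ-+; m<n⇒m%n≡m; m∣n⇒o%n%m≡o%m)
open import Data.Fin using (Fin; toℕ; fromℕ<; inject≤)
open import Data.Fin.Properties using (toℕ-fromℕ<; toℕ-injective; toℕ<n; toℕ-inject≤)
open import Data.Product using (Σ; ∃; _,_)
open import Function.Definitions using (StrictlySurjective)
open import Relation.Nullary using (¬_)
open import Relation.Binary.PropositionalEquality
open ≡-Reasoning

[1+m%n]%n≡[1+m]%n : ∀ m n .{{_ : NonZero n}} → suc (m % n) % n ≡ suc m % n
[1+m%n]%n≡[1+m]%n m n = begin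
  (1 + m % n) % n           ≡⟨ %-distribˡ-+ 1 (m % n) n ⟩
  (1 % n + m % n % n) % n   ≡⟨ cong (λ x → (1 % n + x) % n) (m%n%n≡m%n m n) ⟩
  (1 % n + m % n) % n       ≡⟨ %-distribˡ-+ 1 m n ⟨
  (1 + m) % n               ∎

toℕ-next : ∀ {k} .{{_ : NonZero k}} (i : Fin k) → toℕ (next i) ≡ suc (toℕ i) % k
toℕ-next i = toℕ-fromℕ< _

CircularlyPartite-map : ∀ {n} (G : Graph n) {k ℓ} .{{_ : NonZero k}} .{{_ : NonZero ℓ}}
  (f : Fin k → Fin ℓ) → StrictlySurjective _≡_ f → (∀ i → f (next i) ≡ next (f i)) →
  CircularlyPartite G k → CircularlyPartite G ℓ
CircularlyPartite-map G f f-surjective f-next (c , nonempty , compatible) =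
  (λ v w e → f (c v w e)) , nonempty′ , compatible′
  where
  nonempty′ : ∀ j → ∃ λ v → ∃ λ w → Σ (Adj G v w) λ e → f (c v w e) ≡ j
  nonempty′ j =
    let (i , fi≡j) = f-surjective j
        (v , w , e , c≡i) = nonempty i
    in v , w , e , trans (cong f c≡i) fi≡j

  compatible′ : ∀ v w z (e : Adj G v w) (e′ : Adj G w z) → ¬ (z ≡ v) →
    f (c w z e′) ≡ next (f (c v w e))
  compatible′ v w z e e′ z≢v =
    trans (cong f (compatible v w z e e′ z≢v)) (f-next (c v w e))

module _ {k ℓ : ℕ} .{{_ : NonZero k}} .{{_ : NonZero ℓ}} (ℓ∣k : ℓ ∣ k) where

  reduce : Fin k → Fin ℓ
  reduce i = fromℕ< (m%n<n (toℕ i) ℓ)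

  toℕ-reduce : ∀ i → toℕ (reduce i) ≡ toℕ i % ℓ
  toℕ-reduce i = toℕ-fromℕ< _

  reduce-surjective : StrictlySurjective _≡_ reduce
  reduce-surjective j = inject≤ j (∣⇒≤ ℓ∣k) , toℕ-injective (begin
    toℕ (reduce (inject≤ j _))   ≡⟨ toℕ-reduce _ ⟩
    toℕ (inject≤ j _) % ℓ        ≡⟨ cong (_% ℓ) (toℕ-inject≤ j _) ⟩
    toℕ j % ℓ                    ≡⟨ m<n⇒m%n≡m (toℕ<n j) ⟩
    toℕ j                        ∎)

  reduce-next : ∀ i → reduce (next i) ≡ next (reduce i)
  reduce-next i = toℕ-injective (begin
    toℕ (reduce (next i))        ≡⟨ toℕ-reduce (next i) ⟩
    toℕ (next i) % ℓ             ≡⟨ cong (_% ℓ) (toℕ-next i) ⟩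
    suc (toℕ i) % k % ℓ          ≡⟨ m∣n⇒o%n%m≡o%m ℓ k _ ℓ∣k ⟩
    suc (toℕ i) % ℓ              ≡⟨ [1+m%n]%n≡[1+m]%n (toℕ i) ℓ ⟨
    suc (toℕ i % ℓ) % ℓ          ≡⟨ cong (λ x → suc x % ℓ) (toℕ-reduce i) ⟨
    suc (toℕ (reduce i)) % ℓ     ≡⟨ toℕ-next (reduce i) ⟨
    toℕ (next (reduce i))        ∎)

corollary2p5 : (n : ℕ) (G : Graph n) → Connected G →
    (k ℓ : ℕ) .{{_ : NonZero k}} .{{_ : NonZero ℓ}} →
    CircularlyPartite G k → ℓ ∣ k → CircularlyPartite G ℓ
corollary2p5 n G _ k ℓ partition ℓ∣k =
  CircularlyPartite-map G (reduce ℓ∣k) (reduce-surjective ℓ∣k) (reduce-next ℓ∣k) partition
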